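{- Let $k \geq 3$ be an integer. Then there exists an integer $m \geq 1$ such that for every edge coloring $c$ of the complete directed graph $K_m^*$ with $3$ colors, there exists a set $S$ of $k$ vertices of $K_m^*$ such that for every $x \in S$ there is a color $i_x \in \{0,1,2\}$ with $c((y,x)) \neq i_x$ for all $y \in S\setminus\{x\}$ (i.e. the edges from vertices of $S$ to $x$ avoid at least one color).
   Context: The complete directed graph $K_m^*$ has $m$ vertices and edge set consisting of all ordered pairs $(a,b)$ of distinct vertices. An edge coloring with $3$ colors is a function from this edge set to $\{0,1,2\}$. -}

module Defs where

open import Data.Nat using (ℕ)
open import Data.Fin using (Fin)
open import Data.Fin.Subset using (Subset; _∈_; ∣_∣)
open import Data.Product using (∃-syntax)
open import Relation.Binary.PropositionalEquality using (_≡_; _≢_)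

-- The complete directed graph K_m^* has vertex set Fin m and edge set the
-- ordered pairs (a , b) with a ≢ b.  A 3-edge-colouring assigns a colour in
-- Fin 3 = {0,1,2} to every such edge.
EdgeColoring3 : ℕ → Set
EdgeColoring3 m = (a b : Fin m) → a ≢ b → Fin 3

InAvoiding : {m : ℕ} → EdgeColoring3 m → Subset m → Set
InAvoiding {m} c S =
  (x : Fin m) → x ∈ S →
    ∃[ i ] ((y : Fin m) → y ∈ S → (y≢x : y ≢ x) → c y x y≢x ≢ i)

{-# OPTIONS --safe #-}
-- Choose vertices greedily from a shrinking pool: having chosen v, pick by pigeonhole colours
-- α, β such that at least a ninth of the remaining pool has c(v,w) = α and c(w,v) = β, and keep
-- only those w.  Then every edge from v to a later vertex has colour α and every edge back has
-- colour β.  Among 3k chosen vertices, k share the same α; within them, the edges into x come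
-- from earlier vertices (colour α) or later ones (the β of x), so x avoids the third colour.
module Submission where

open import Defs
open import Data.Nat using (ℕ; _≥_; _≤_)
open import Data.Fin.Subset using (Subset; ∣_∣)
open import Data.Product using (∃-syntax; _×_)
open import Relation.Binary.PropositionalEquality using (_≡_)

open import Data.Nat using (zero; suc; _+_; _*_; _<_; _≤?_; z≤n; s≤s)
open import Data.Nat.Properties
  using (+-suc; +-assoc; +-identityʳ; +-mono-<; ≰⇒>; <⇒≱; ≤-reflexive; n≤1+n; m≤n⇒m⊓n≡m)
open import Data.Fin using (Fin; zero; suc; _≟_)
open import Data.Fin.Patterns using (0F; 1F; 2F)
open import Data.Fin.Subset using (inside; outside; ⁅_⁆; _∪_; ⋃) renaming (_∈_ to _∈ₛ_; _∉_ to _∉ₛ_)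
open import Data.Fin.Subset.Properties using (∉⊥; ∣⊥∣≡0; ∪-identityˡ; x∈p∪q⁻; x∈⁅y⁆⇒x≡y)
open import Data.Vec using (_∷_; here; there)
open import Data.List using (List; []; _∷_; length; map; filter; take; allFin)
open import Data.List.Properties using (length-map; length-take; length-tabulate)
open import Data.List.Membership.Propositional using (_∈_)
open import Data.List.Membership.Propositional.Properties using (∈-filter⁻; ∈-map⁻)
open import Data.List.Relation.Unary.Any using (here; there)
open import Data.List.Relation.Unary.All as All using (All; []; _∷_)
import Data.List.Relation.Unary.All.Properties as All
open import Data.List.Relation.Unary.AllPairs as AllPairs using (AllPairs; []; _∷_)
import Data.List.Relation.Unary.AllPairs.Properties as AllPairs
open import Data.List.Relation.Unary.Unique.Propositional using (Unique)
import Data.List.Relation.Unary.Unique.Propositional.Properties as Unique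
open import Data.Product using (_,_; proj₁)
open import Data.Sum using (_⊎_; inj₁; inj₂; [_,_])
open import Data.Empty using (⊥-elim)
open import Function using (_∘_)
open import Relation.Nullary using (yes; no)
open import Relation.Binary.PropositionalEquality using (_≢_; refl; sym; trans; cong; subst; subst₂)

third-colour : (a b : Fin 3) → ∃[ i ] (i ≢ a × i ≢ b)
third-colour 0F 0F = 1F , (λ ()) , (λ ())
third-colour 0F 1F = 2F , (λ ()) , (λ ())
third-colour 0F 2F = 1F , (λ ()) , (λ ())
third-colour 1F 0F = 2F , (λ ()) , (λ ())
third-colour 1F 1F = 0F , (λ ()) , (λ ())
third-colour 1F 2F = 0F , (λ ()) , (λ ())
third-colour 2F 0F = 1F , (λ ()) , (λ ())
third-colour 2F 1F = 0F , (λ ()) , (λ ())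
third-colour 2F 2F = 0F , (λ ()) , (λ ())

module _ {A : Set} (f : A → Fin 3) where

  colourClass : Fin 3 → List A → List A
  colourClass i = filter (λ x → f x ≟ i)

  length-colourClasses : ∀ xs →
    length (colourClass 0F xs) + length (colourClass 1F xs) + length (colourClass 2F xs)
      ≡ length xs
  length-colourClasses [] = refl
  length-colourClasses (x ∷ xs) with f x | length-colourClasses xs
  ... | 0F | eq = cong suc eq
  ... | 1F | eq =
    trans (cong (_+ length (colourClass 2F xs)) (+-suc (length (colourClass 0F xs)) _))
          (cong suc eq)
  ... | 2F | eq = trans (+-suc _ _) (cong suc eq)

  colourClass-pigeonhole : ∀ n xs → 3 * n ≤ length xs → ∃[ i ] (n ≤ length (colourClass i xs))
  colourClass-pigeonhole n xs bound
    with n ≤? length (colourClass 0F xs)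
       | n ≤? length (colourClass 1F xs)
       | n ≤? length (colourClass 2F xs)
  ... | yes n≤ | _      | _      = 0F , n≤
  ... | no _   | yes n≤ | _      = 1F , n≤
  ... | no _   | no _   | yes n≤ = 2F , n≤
  ... | no n≰₀ | no n≰₁ | no n≰₂ = ⊥-elim (<⇒≱ length<3n bound)
    where
    3n≡ : n + n + n ≡ 3 * n
    3n≡ = trans (+-assoc n n n) (cong (λ z → n + (n + z)) (sym (+-identityʳ n)))

    length<3n : length xs < 3 * n
    length<3n = subst₂ _<_ (length-colourClasses xs) 3n≡
      (+-mono-< (+-mono-< (≰⇒> n≰₀) (≰⇒> n≰₁)) (≰⇒> n≰₂))

module _ {ℓ} {A : Set ℓ} {R : A → A → Set ℓ} where

  AllPairs-members : ∀ {xs x y} → AllPairs R xs → x ∈ xs → y ∈ xs → x ≡ y ⊎ R x y ⊎ R y x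
  AllPairs-members (_  ∷ _)   (here refl) (here refl) = inj₁ refl
  AllPairs-members (Rx ∷ _)   (here refl) (there y∈)  = inj₂ (inj₁ (All.lookup Rx y∈))
  AllPairs-members (Rx ∷ _)   (there x∈)  (here refl) = inj₂ (inj₂ (All.lookup Rx x∈))
  AllPairs-members (_  ∷ Rxs) (there x∈)  (there y∈)  = AllPairs-members Rxs x∈ y∈

record Entry (V : Set) : Set where
  constructor entry
  field
    vertex    : V
    outColour : Fin 3
    inColour  : Fin 3
open Entry

towerBound : ℕ → ℕ
towerBound zero    = 0
towerBound (suc n) = suc (3 * (3 * towerBound n))

module _ {V : Set} (d : V → V → Fin 3) where

  Precedes : Entry V → Entry V → Set
  Precedes (entry x α β) e = x ≢ vertex e × d x (vertex e) ≡ α × d (vertex e) x ≡ β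

  Tower : List (Entry V) → Set
  Tower = AllPairs Precedes

  tower-vertices-unique : ∀ {t} → Tower t → Unique (map vertex t)
  tower-vertices-unique = AllPairs.map⁺ ∘ AllPairs.map proj₁

  greedy-tower : ∀ n (pool : List V) → Unique pool → towerBound n ≤ length pool →
                 ∃[ t ] (length t ≡ n × Tower t × All ((_∈ pool) ∘ vertex) t)
  greedy-tower zero    pool       _                _            = [] , refl , [] , []
  greedy-tower (suc n) (v ∷ rest) (v∉rest ∷ rest!) (s≤s bound) =
    let (β , bound′) = colourClass-pigeonhole (λ w → d w v) (3 * towerBound n) rest bound
        (α , bound″) =
          colourClass-pigeonhole (d v) (towerBound n) (colourClass (λ w → d w v) β rest) bound′
        (t , length-t , tower , t⊆pool) =
          greedy-tower n (pool α β) (Unique.filter⁺ _ (Unique.filter⁺ _ rest!)) bound″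
    in entry v α β ∷ t , cong suc length-t ,
       All.map (λ {e} → v-precedes α β {e}) t⊆pool ∷ tower ,
       here refl ∷ All.map (there ∘ proj₁ ∘ ∈-pool α β) t⊆pool
    where
    pool : Fin 3 → Fin 3 → List V
    pool α β = colourClass (d v) α (colourClass (λ w → d w v) β rest)

    ∈-pool : ∀ α β {w} → w ∈ pool α β → w ∈ rest × d v w ≡ α × d w v ≡ β
    ∈-pool α β w∈ =
      let (w∈′ , vw≡α) = ∈-filter⁻ (λ w → d v w ≟ α) w∈
          (w∈rest , wv≡β) = ∈-filter⁻ (λ w → d w v ≟ β) w∈′
      in w∈rest , vw≡α , wv≡β

    v-precedes : ∀ α β {e} → vertex e ∈ pool α β → Precedes (entry v α β) e
    v-precedes α β e∈ =
      let (e∈rest , vw≡α , wv≡β) = ∈-pool α β e∈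
      in All.lookup v∉rest e∈rest , vw≡α , wv≡β

  monochromatic-subtower : ∀ k {t} → Tower t → 3 * k ≤ length t →
    ∃[ α ] ∃[ s ] (length s ≡ k × Tower s × All ((_≡ α) ∘ outColour) s)
  monochromatic-subtower k {t} tower bound =
    let (α , k≤class) = colourClass-pigeonhole outColour k t bound
        class = colourClass outColour α t
    in α , take k class , trans (length-take k class) (m≤n⇒m⊓n≡m k≤class) ,
       AllPairs.take⁺ k (AllPairs.filter⁺ _ tower) , All.take⁺ k (All.all-filter _ t)

  monochromatic-tower-in-colours : ∀ {α t e y} → Tower t → All ((_≡ α) ∘ outColour) t →
    e ∈ t → y ∈ map vertex t → y ≢ vertex e →
    d y (vertex e) ≡ α ⊎ d y (vertex e) ≡ inColour e
  monochromatic-tower-in-colours tower mono e∈ y∈ y≢x with ∈-map⁻ vertex y∈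
  ... | e′ , e′∈ , refl with AllPairs-members tower e∈ e′∈
  ... | inj₁ refl                         = ⊥-elim (y≢x refl)
  ... | inj₂ (inj₁ (_ , _ , d≡β))         = inj₂ d≡β
  ... | inj₂ (inj₂ (_ , d≡outColour , _)) = inj₁ (trans d≡outColour (All.lookup mono e′∈))

  monochromatic-tower-avoids : ∀ {α t e} → Tower t → All ((_≡ α) ∘ outColour) t → e ∈ t →
    ∃[ i ] (∀ {y} → y ∈ map vertex t → y ≢ vertex e → d y (vertex e) ≢ i)
  monochromatic-tower-avoids {α} {e = e} tower mono e∈ =
    let (i , i≢α , i≢β) = third-colour α (inColour e)
    in i , λ y∈ y≢x d≡i →
         [ i≢α ∘ trans (sym d≡i) , i≢β ∘ trans (sym d≡i) ]
           (monochromatic-tower-in-colours tower mono e∈ y∈ y≢x)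

fromList : ∀ {n} → List (Fin n) → Subset n
fromList xs = ⋃ (map ⁅_⁆ xs)

∈-fromList⁻ : ∀ {n} {x : Fin n} xs → x ∈ₛ fromList xs → x ∈ xs
∈-fromList⁻ []       x∈ = ⊥-elim (∉⊥ x∈)
∈-fromList⁻ (y ∷ xs) x∈ with x∈p∪q⁻ ⁅ y ⁆ (fromList xs) x∈
... | inj₁ x∈⁅y⁆ = here (x∈⁅y⁆⇒x≡y y x∈⁅y⁆)
... | inj₂ x∈xs  = there (∈-fromList⁻ xs x∈xs)

∣⁅x⁆∪p∣≡1+∣p∣ : ∀ {n} {x : Fin n} {p} → x ∉ₛ p → ∣ ⁅ x ⁆ ∪ p ∣ ≡ suc ∣ p ∣
∣⁅x⁆∪p∣≡1+∣p∣ {x = zero}  {inside  ∷ p} x∉ = ⊥-elim (x∉ here)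
∣⁅x⁆∪p∣≡1+∣p∣ {x = zero}  {outside ∷ p} _  = cong (suc ∘ ∣_∣) (∪-identityˡ p)
∣⁅x⁆∪p∣≡1+∣p∣ {x = suc x} {inside  ∷ p} x∉ = cong suc (∣⁅x⁆∪p∣≡1+∣p∣ (x∉ ∘ there))
∣⁅x⁆∪p∣≡1+∣p∣ {x = suc x} {outside ∷ p} x∉ = ∣⁅x⁆∪p∣≡1+∣p∣ (x∉ ∘ there)

∣fromList∣ : ∀ {n} {xs : List (Fin n)} → Unique xs → ∣ fromList xs ∣ ≡ length xs
∣fromList∣ {n} {[]}     []            = ∣⊥∣≡0 n
∣fromList∣ {xs = x ∷ xs} (x∉xs ∷ xs!) =
  trans (∣⁅x⁆∪p∣≡1+∣p∣ (λ x∈ → All.lookup x∉xs (∈-fromList⁻ xs x∈) refl))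
        (cong suc (∣fromList∣ xs!))

-- The value 0F on the diagonal is junk; it is never read, since K_m^* has no loops.
totalColouring : ∀ {m} → EdgeColoring3 m → Fin m → Fin m → Fin 3
totalColouring c a b with a ≟ b
... | yes _  = 0F
... | no a≢b = c a b a≢b

totalColouring-≡ : ∀ {m} (c : EdgeColoring3 m) {a b} (a≢b : a ≢ b) →
                   c a b a≢b ≡ totalColouring c a b
totalColouring-≡ c {a} {b} a≢b with a ≟ b
... | yes a≡b = ⊥-elim (a≢b a≡b)
... | no _    = refl

monochromatic-tower-InAvoiding : ∀ {m} (c : EdgeColoring3 m) {α t} →
  Tower (totalColouring c) t → All ((_≡ α) ∘ outColour) t → InAvoiding c (fromList (map vertex t))
monochromatic-tower-InAvoiding c tower mono x x∈ with ∈-map⁻ vertex (∈-fromList⁻ _ x∈)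
... | e , e∈ , refl =
  let (i , avoids) = monochromatic-tower-avoids (totalColouring c) tower mono e∈
  in i , λ y y∈ y≢x → avoids (∈-fromList⁻ _ y∈) y≢x ∘ trans (sym (totalColouring-≡ c y≢x))

InAvoiding-subset-of-size : ∀ k {m} → towerBound (3 * k) ≤ m → (c : EdgeColoring3 m) →
  ∃[ S ] (∣ S ∣ ≡ k × InAvoiding c S)
InAvoiding-subset-of-size k {m} bound c =
  let (t , length-t , tower , _) =
        greedy-tower d (3 * k) (allFin m) (Unique.allFin⁺ m)
          (subst (_ ≤_) (sym (length-tabulate _)) bound)
      (α , s , length-s , tower-s , mono) =
        monochromatic-subtower d k tower (≤-reflexive (sym length-t))
  in fromList (map vertex s) ,
     trans (∣fromList∣ (tower-vertices-unique d tower-s)) (trans (length-map vertex s) length-s) ,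
     monochromatic-tower-InAvoiding c tower-s mono
  where
  d : Fin m → Fin m → Fin 3
  d = totalColouring c

-- The construction works for every k.
proposition3p1 : (k : ℕ) → k ≥ 3 →
    ∃[ m ] (m ≥ 1 × ((c : EdgeColoring3 m) →
      ∃[ S ] (∣ S ∣ ≡ k × InAvoiding c S)))
proposition3p1 k _ = suc (towerBound (3 * k)) , s≤s z≤n , InAvoiding-subset-of-size k (n≤1+n _)
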